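{- Let $p$ be a prime, $d>e\ge1$ coprime integers, $a\ge1$, $t$ an integer and $n\ge0$. For $i\in\mathbb{N}\times I_a$ write $i=(i',i'')$. Then for every permutation $\tau$ of $I_n^*\times I_a$, $$\sum_{i\in I_n^*\times I_a}\phi\big(pi'-\tau(i)'+t\big)\ge\frac ad\left(\frac{(p-1)n(n+1)}{2}+(n+1)t+(d-e)C_{t,n}\right).$$
   Context: $I_a=\{1,\dots,a\}$, $I_n^*=\{0,\dots,n\}$, and $\tau(i)'$ denotes the first coordinate of $\tau(i)$. For an integer $k$, $\phi(k)=\min\{x+y: dx+ey=k,\ x,y\in\mathbb{N}\}\in\mathbb{N}\cup\{+\infty\}$ (minimum of the empty set is $+\infty$). $\overline{x}$ is the least non-negative residue of $x$ mod $d$, $e^{ -1}$ the inverse of $e$ mod $d$, $S_n^*$ the set of permutations of $I_n^*$, and $C_{t,n}=\min_{\sigma\in S_n^*}\sum_{i=0}^n\overline{e^{ -1}(pi-\sigma(i)+t)}$. -}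

module Defs where

open import Data.Nat as ℕ using (ℕ; zero; suc; NonZero)
open import Data.Integer as ℤ using (ℤ; +_)
open import Data.Integer.DivMod using (_%ℕ_)
open import Data.Fin as Fin using (Fin; toℕ)
open import Data.Product using (Σ; _×_; _,_; ∃; ∃₂)
open import Function.Bundles using (_↔_; Inverse)
open import Relation.Binary.PropositionalEquality using (_≡_)

sumFin : (n : ℕ) → (Fin n → ℤ) → ℤ
sumFin zero    f = + 0
sumFin (suc n) f = f Fin.zero ℤ.+ sumFin n (λ i → f (Fin.suc i))

Rep : (d e : ℕ) → ℤ → ℕ → ℕ → Set
Rep d e k x y = (+ d ℤ.* + x) ℤ.+ (+ e ℤ.* + y) ≡ k

-- IsPhi d e k m  :  φ(k) = min{x+y : dx+ey=k, x,y∈ℕ} is finite and equals m.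
-- (φ(k) = +∞ exactly when no m satisfies IsPhi d e k m.)
IsPhi : (d e : ℕ) → ℤ → ℕ → Set
IsPhi d e k m =
  (∃₂ λ x y → Rep d e k x y × x ℕ.+ y ≡ m)
  × (∀ x y → Rep d e k x y → m ℕ.≤ x ℕ.+ y)

IsInvMod : (d e einv : ℕ) .{{_ : NonZero d}} → Set
IsInvMod d e einv = (+ e ℤ.* + einv) %ℕ d ≡ 1

-- I_n^* = {0,…,n} is represented by Fin (suc n) (via toℕ);
-- S_n^* = permutations of I_n^*.
Perm* : ℕ → Set
Perm* n = Fin (suc n) ↔ Fin (suc n)

costC : (d einv p : ℕ) (t : ℤ) (n : ℕ) .{{_ : NonZero d}} → Perm* n → ℤ
costC d einv p t n σ =
  sumFin (suc n) λ i →
    + ((+ einv ℤ.* ((+ p ℤ.* + toℕ i) ℤ.- + toℕ (Inverse.to σ i) ℤ.+ t)) %ℕ d)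

IsC : (d einv p : ℕ) (t : ℤ) (n : ℕ) .{{_ : NonZero d}} → ℤ → Set
IsC d einv p t n C =
  (∃ λ σ → C ≡ costC d einv p t n σ) × (∀ σ → C ℤ.≤ costC d einv p t n σ)

{-# OPTIONS --safe #-}
module Submission where

-- If k = dx + ey with x + y = φ(k), then y ≡ e⁻¹k (mod d), so y is at least the residue of e⁻¹k and
-- d·φ(k) = k + (d − e)·y ≥ k + (d − e)·(e⁻¹k mod d).  Sum this over i = (i′, i″).  The arguments
-- k = p i′ − τ(i)′ + t add up to a((p − 1)n(n + 1)/2 + (n + 1)t), because τ permutes the first
-- coordinates with multiplicity a.  The residues are the costs c(i′, τ(i)′) of the edges of the
-- a-regular bipartite multigraph {(i′, τ(i)′)} on I_n^*.  By Hall's theorem (proved with Rado's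
-- edge-deletion argument) it splits into a perfect matchings, each a permutation σ of cost at
-- least C_{t,n}; hence the residues add up to at least a·C_{t,n}.

open import Defs
open import Data.Nat as ℕ using (ℕ; suc; NonZero)
open import Data.Nat.Primality using (Prime)
open import Data.Nat.Coprimality using (Coprime)
open import Data.Integer as ℤ using (ℤ; +_)
open import Data.Fin using (Fin; toℕ)
open import Data.Product using (_×_; _,_; proj₁)
open import Function.Bundles using (_↔_; Inverse)

import Algebra.Properties.Semiring.Sum as SemiringSum
open import Data.Bool using (Bool; true; false; T; not; _∧_; _∨_)
open import Data.Bool.Properties using (T-≡; T-∧; T-∨; T-not-≡; ∧-identityʳ; ∧-zeroʳ)
open import Data.Empty using (⊥-elim)
open import Data.Fin as Fin using (_≟_)
open import Data.Fin.Properties using (any?; injective⇒≤; punchOut-injective; remQuot-combine; *↔×)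
open import Data.Fin.Subset.Properties using (anySubset?)
import Data.Integer.Properties as ℤₚ
open import Data.Integer.DivMod using (_%ℕ_)
import Data.Integer.Tactic.RingSolver as ℤSolver
open import Data.Nat using (zero; _+_; _*_; _∸_; _≤_; _<_; z≤n; s≤s; _<ᵇ_)
open import Data.Nat.DivMod using (_%_; [m+kn]%n≡m%n; %-distribˡ-*; m%n%n≡m%n; m%n≤m)
open import Data.Nat.Induction using (<-wellFounded)
open import Data.Nat.Primality using (¬prime[0])
open import Data.Nat.Properties hiding (_≟_)
open import Data.Nat.Tactic.RingSolver using (solve-∀)
open import Data.Product using (Σ; ∃; proj₂; uncurry)
open import Data.Sum using (_⊎_; inj₁; inj₂)
open import Data.Vec using (lookup; tabulate)
open import Data.Vec.Properties using (lookup∘tabulate)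
open import Function.Base using (_∘_)
open import Function.Bundles using (Equivalence; mk↔ₛ′; _⇔_; mk⇔)
open import Function.Construct.Composition using (_↔-∘_)
open import Function.Construct.Symmetry using (↔-sym)
open import Function.Definitions using (Injective)
open import Induction.WellFounded using (Acc; acc)
open import Relation.Binary.PropositionalEquality
open import Relation.Nullary using (¬_; Dec; yes; no; does; ¬?; _×-dec_)
open import Relation.Nullary.Decidable using (T?; ⌊_⌋; toWitness; fromWitness; dec-true; dec-false; does-⇔)

import Algebra.Properties.CommutativeSemigroup ℤₚ.+-commutativeSemigroup as ℤ+
open Equivalence using (to; from)
open module ℕΣ = SemiringSum +-*-semiring using (sum; sum-cong-≗; ∑-distrib-+; ∑-comm)

sum-mono-≤ : ∀ {n} {f g : Fin n → ℕ} → (∀ i → f i ≤ g i) → sum f ≤ sum g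
sum-mono-≤ {zero}  f≤g = z≤n
sum-mono-≤ {suc n} f≤g = +-mono-≤ (f≤g Fin.zero) (sum-mono-≤ (f≤g ∘ Fin.suc))

sum-mono-< : ∀ {n} {f g : Fin n → ℕ} (i : Fin n) → (∀ j → f j ≤ g j) → f i < g i → sum f < sum g
sum-mono-< Fin.zero    f≤g fi<gi = +-mono-<-≤ fi<gi (sum-mono-≤ (f≤g ∘ Fin.suc))
sum-mono-< (Fin.suc i) f≤g fi<gi = +-mono-≤-< (f≤g Fin.zero) (sum-mono-< i (f≤g ∘ Fin.suc) fi<gi)

sum-const : ∀ n c → sum {n} (λ _ → c) ≡ n * c
sum-const zero    c = refl
sum-const (suc n) c = cong (_+_ c) (sum-const n c)

𝟙 : Bool → ℕ
𝟙 true  = 1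
𝟙 false = 0

sum-pickʳ : ∀ {n} (x : Fin n) (g : Fin n → ℕ) → sum (λ l → 𝟙 (does (x ≟ l)) * g l) ≡ g x
sum-pickʳ {suc n} Fin.zero    g =
  trans (cong₂ _+_ (+-identityʳ (g Fin.zero)) (ℕΣ.sum-replicate-zero n)) (+-identityʳ (g Fin.zero))
sum-pickʳ {suc n} (Fin.suc x) g = sum-pickʳ x (g ∘ Fin.suc)

sum-pickˡ : ∀ {n} (x : Fin n) (g : Fin n → ℕ) → sum (λ j → 𝟙 (does (j ≟ x)) * g j) ≡ g x
sum-pickˡ x g =
  trans (sum-cong-≗ (λ j → cong (λ b → 𝟙 b * g j) (does-⇔ (mk⇔ sym sym) (j ≟ x) (x ≟ j))))
        (sum-pickʳ x g)

sum-𝟙≟ : ∀ {n} (x : Fin n) → sum (λ l → 𝟙 (does (x ≟ l))) ≡ 1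
sum-𝟙≟ x = trans (sum-cong-≗ (λ l → sym (*-identityʳ (𝟙 (does (x ≟ l)))))) (sum-pickʳ x (λ _ → 1))

𝟙-mono : ∀ {a b} → (T a → T b) → 𝟙 a ≤ 𝟙 b
𝟙-mono {false}         _   = z≤n
𝟙-mono {true}  {true}  _   = ≤-refl
𝟙-mono {true}  {false} a⇒b = ⊥-elim (a⇒b _)

𝟙-< : ∀ {a b} → ¬ T a → T b → 𝟙 a < 𝟙 b
𝟙-< {false} {true} _ _ = s≤s z≤n
𝟙-< {true}         ¬a _ = ⊥-elim (¬a _)

𝟙∨+𝟙∧ : ∀ a b → 𝟙 (a ∨ b) + 𝟙 (a ∧ b) ≡ 𝟙 a + 𝟙 b
𝟙∨+𝟙∧ true  true  = refl
𝟙∨+𝟙∧ true  false = refl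
𝟙∨+𝟙∧ false b     = +-identityʳ (𝟙 b)

infix  4 _⊆_
infixl 6 _∪_
infixl 7 _∩_
infixl 6 _─_

card : ∀ {n} → (Fin n → Bool) → ℕ
card S = sum (𝟙 ∘ S)

_⊆_ : ∀ {n} → (Fin n → Bool) → (Fin n → Bool) → Set
S ⊆ S′ = ∀ {i} → T (S i) → T (S′ i)

_∪_ _∩_ : ∀ {n} → (Fin n → Bool) → (Fin n → Bool) → Fin n → Bool
(S ∪ S′) i = S i ∨ S′ i
(S ∩ S′) i = S i ∧ S′ i

card-mono : ∀ {n} {S S′ : Fin n → Bool} → S ⊆ S′ → card S ≤ card S′
card-mono {S = S} {S′} S⊆S′ = sum-mono-≤ {f = 𝟙 ∘ S} {g = 𝟙 ∘ S′} (λ i → 𝟙-mono S⊆S′)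

card∪+card∩ : ∀ {n} (S S′ : Fin n → Bool) → card (S ∪ S′) + card (S ∩ S′) ≡ card S + card S′
card∪+card∩ S S′ = begin
  card (S ∪ S′) + card (S ∩ S′)               ≡⟨ ∑-distrib-+ (𝟙 ∘ (S ∪ S′)) (𝟙 ∘ (S ∩ S′)) ⟨
  sum (λ i → 𝟙 (S i ∨ S′ i) + 𝟙 (S i ∧ S′ i)) ≡⟨ sum-cong-≗ (λ i → 𝟙∨+𝟙∧ (S i) (S′ i)) ⟩
  sum (λ i → 𝟙 (S i) + 𝟙 (S′ i))              ≡⟨ ∑-distrib-+ (𝟙 ∘ S) (𝟙 ∘ S′) ⟩
  card S + card S′                            ∎
  where open ≡-Reasoning

0<card⇒nonempty : ∀ {n} (S : Fin n → Bool) → 0 < card S → ∃ λ i → T (S i)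
0<card⇒nonempty {suc n} S 0<card with S Fin.zero in eq
... | true  = Fin.zero , subst T (sym eq) _
... | false with 0<card⇒nonempty (S ∘ Fin.suc) 0<card
...   | i , Si = Fin.suc i , Si

-- Kept opaque so that a membership proof determines the set by unification.
opaque
  ⁅_⁆ : ∀ {n} → Fin n → Fin n → Bool
  ⁅ x ⁆ i = does (x ≟ i)

  x∈⁅x⁆ : ∀ {n} (x : Fin n) → T (⁅ x ⁆ x)
  x∈⁅x⁆ x = from T-≡ (dec-true (x ≟ x) refl)

  ∈⁅x⁆⁻ : ∀ {n} {x i : Fin n} → T (⁅ x ⁆ i) → i ≡ x
  ∈⁅x⁆⁻ {x = x} {i} i∈ with x ≟ i
  ... | yes x≡i = sym x≡i

  card⁅x⁆≡1 : ∀ {n} (x : Fin n) → card ⁅ x ⁆ ≡ 1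
  card⁅x⁆≡1 = sum-𝟙≟

opaque
  _─_ : ∀ {n} → (Fin n → Bool) → Fin n → Fin n → Bool
  (S ─ x) i = S i ∧ not (does (i ≟ x))

  ∈─ : ∀ {n} {S : Fin n → Bool} {x i} → T (S i) → i ≢ x → T ((S ─ x) i)
  ∈─ {x = x} {i} Si i≢x = from T-∧ (Si , from T-not-≡ (dec-false (i ≟ x) i≢x))

  ∈─⁻ : ∀ {n} {S : Fin n → Bool} {x i} → T ((S ─ x) i) → T (S i) × i ≢ x
  ∈─⁻ {x = x} {i} i∈ with i ≟ x
  ... | no i≢x = proj₁ (to T-∧ i∈) , i≢x
  ... | yes _  = ⊥-elim (proj₂ (to T-∧ i∈))

  card≡1+card─ : ∀ {n} (S : Fin n → Bool) x → T (S x) → card S ≡ suc (card (S ─ x))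
  card≡1+card─ {suc n} S Fin.zero Sx with S Fin.zero
  ... | true  = cong suc (sum-cong-≗ (λ i → cong 𝟙 (sym (∧-identityʳ (S (Fin.suc i))))))
  card≡1+card─ {suc n} S (Fin.suc x) Sx = begin
    𝟙 (S Fin.zero) + card (S ∘ Fin.suc)
      ≡⟨ cong (_+_ (𝟙 (S Fin.zero))) (card≡1+card─ (S ∘ Fin.suc) x Sx) ⟩
    𝟙 (S Fin.zero) + suc (card ((S ∘ Fin.suc) ─ x))
      ≡⟨ +-suc (𝟙 (S Fin.zero)) (card ((S ∘ Fin.suc) ─ x)) ⟩
    suc (𝟙 (S Fin.zero) + card ((S ∘ Fin.suc) ─ x))
      ≡⟨ cong (λ b → suc (𝟙 b + card ((S ∘ Fin.suc) ─ x))) (∧-identityʳ (S Fin.zero)) ⟨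
    suc (card (S ─ Fin.suc x))
      ∎
    where open ≡-Reasoning

module Hall {N : ℕ} where

  Graph : Set
  Graph = Fin N → Fin N → Bool

  opaque
    𝓝 : Graph → (Fin N → Bool) → Fin N → Bool
    𝓝 A S l = ⌊ any? (λ j → T? (S j ∧ A j l)) ⌋

    ∈𝓝 : ∀ {A S j l} → T (S j) → T (A j l) → T (𝓝 A S l)
    ∈𝓝 {j = j} Sj Ajl = fromWitness (j , from T-∧ (Sj , Ajl))

    ∈𝓝⁻ : ∀ {A S l} → T (𝓝 A S l) → ∃ λ j → T (S j) × T (A j l)
    ∈𝓝⁻ l∈𝓝 with j , SAjl ← toWitness l∈𝓝 = j , to T-∧ SAjl

  𝓝-mono : ∀ A {S S′} → S ⊆ S′ → 𝓝 A S ⊆ 𝓝 A S′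
  𝓝-mono A S⊆S′ l∈𝓝 with j , Sj , Ajl ← ∈𝓝⁻ l∈𝓝 = ∈𝓝 (S⊆S′ Sj) Ajl

  HallCondition : Graph → Set
  HallCondition A = ∀ S → card S ≤ card (𝓝 A S)

  hall? : ∀ A → HallCondition A ⊎ ∃ λ (S : Fin N → Bool) → card (𝓝 A S) < card S
  hall? A with anySubset? (λ v → card (𝓝 A (lookup v)) <? card (lookup v))
  ... | yes (v , violation) = inj₂ (lookup v , violation)
  ... | no ¬violation = inj₁ hallA
    where
    hallA : HallCondition A
    hallA S = begin
      card S          ≡⟨ sum-cong-≗ (λ i → cong 𝟙 (lookup∘tabulate S i)) ⟨
      card S′         ≤⟨ ≮⇒≥ (¬violation ∘ (tabulate S ,_)) ⟩
      card (𝓝 A S′)   ≤⟨ card-mono {S = 𝓝 A S′} {S′ = 𝓝 A S} (𝓝-mono A λ {i} → subst T (lookup∘tabulate S i)) ⟩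
      card (𝓝 A S)    ∎
      where
      open ≤-Reasoning
      S′ = lookup (tabulate S)

  opaque
    delete : Graph → Fin N → Fin N → Graph
    delete A r x j l = A j l ∧ not (does (j ≟ r) ∧ does (l ≟ x))

    delete⊆ : ∀ {A r x j l} → T (delete A r x j l) → T (A j l)
    delete⊆ = proj₁ ∘ to T-∧

    delete-removes : ∀ {A r x} → ¬ T (delete A r x r x)
    delete-removes {r = r} {x} rx∈ with r ≟ r | x ≟ x
    ... | yes _   | yes _   = proj₂ (to T-∧ rx∈)
    ... | no r≢r  | _       = r≢r refl
    ... | yes _   | no x≢x  = x≢x refl

    delete-keeps-row : ∀ {A r x j l} → j ≢ r → T (A j l) → T (delete A r x j l)
    delete-keeps-row {r = r} {x} {j} {l} j≢r Ajl =
      from T-∧ (Ajl , from T-not-≡ (cong (_∧ does (l ≟ x)) (dec-false (j ≟ r) j≢r)))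

    delete-keeps-column : ∀ {A r x j l} → l ≢ x → T (A j l) → T (delete A r x j l)
    delete-keeps-column {r = r} {x} {j} {l} l≢x Ajl =
      from T-∧ (Ajl , from T-not-≡ (trans (cong (does (j ≟ r) ∧_) (dec-false (l ≟ x) l≢x)) (∧-zeroʳ _)))

  edges : Graph → ℕ
  edges A = sum λ j → card (A j)

  edges-delete : ∀ {A r x} → T (A r x) → edges (delete A r x) < edges A
  edges-delete {A} {r} {x} Arx =
    sum-mono-< r (λ j → card-mono {S = delete A r x j} {S′ = A j} delete⊆)
      (sum-mono-< x (λ l → 𝟙-mono delete⊆) (𝟙-< delete-removes Arx))

  violator-contains-row : ∀ A r x S → HallCondition A → card (𝓝 (delete A r x) S) < card S → T (S r)
  violator-contains-row A r x S hallA violation with T? (S r)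
  ... | yes Sr  = Sr
  ... | no ¬Sr = ⊥-elim (<⇒≱ violation (≤-trans (hallA S) (card-mono {S = 𝓝 A S} {S′ = 𝓝 (delete A r x) S} 𝓝⊆)))
    where
    𝓝⊆ : 𝓝 A S ⊆ 𝓝 (delete A r x) S
    𝓝⊆ l∈ with j , Sj , Ajl ← ∈𝓝⁻ l∈ =
      ∈𝓝 Sj (delete-keeps-row (λ { refl → ¬Sr Sj }) Ajl)

  -- Rado: violators S, S′ of both deletions contain r, and submodularity of neighbourhood counts
  -- would give card S + card S′ ≤ card X + card Y + 1.
  deletion-preserves-Hall : ∀ A r {x y} → HallCondition A → x ≢ y
    → HallCondition (delete A r x) ⊎ HallCondition (delete A r y)
  deletion-preserves-Hall A r {x} {y} hallA x≢y with hall? (delete A r x) | hall? (delete A r y)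
  ... | inj₁ hall-x       | _                 = inj₁ hall-x
  ... | inj₂ _            | inj₁ hall-y       = inj₂ hall-y
  ... | inj₂ (S , vS) | inj₂ (S′ , vS′) = ⊥-elim (<-irrefl refl (begin-strict
    card S + card S′
      ≡⟨ card∪+card∩ S S′ ⟨
    card (S ∪ S′) + card (S ∩ S′)
      ≡⟨ cong (_+_ (card (S ∪ S′))) (card≡1+card─ (S ∩ S′) r (from T-∧ (Sr , S′r))) ⟩
    card (S ∪ S′) + suc (card (S ∩ S′ ─ r))
      ≤⟨ +-mono-≤ (≤-trans (hallA (S ∪ S′)) (card-mono {S = 𝓝 A (S ∪ S′)} 𝓝∪))
                  (s≤s (≤-trans (hallA (S ∩ S′ ─ r)) (card-mono {S = 𝓝 A (S ∩ S′ ─ r)} 𝓝∩))) ⟩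
    card (X ∪ Y) + suc (card (X ∩ Y))         ≡⟨ +-suc (card (X ∪ Y)) (card (X ∩ Y)) ⟩
    suc (card (X ∪ Y) + card (X ∩ Y))         ≡⟨ cong suc (card∪+card∩ X Y) ⟩
    suc (card X + card Y)                     <⟨ s≤s (+-monoʳ-< (card X) (n<1+n (card Y))) ⟩
    suc (card X) + suc (card Y)               ≤⟨ +-mono-≤ vS vS′ ⟩
    card S + card S′                          ∎))
    where
    open ≤-Reasoning
    X = 𝓝 (delete A r x) S
    Y = 𝓝 (delete A r y) S′
    Sr = violator-contains-row A r x S hallA vS
    S′r = violator-contains-row A r y S′ hallA vS′
    𝓝∪ : 𝓝 A (S ∪ S′) ⊆ X ∪ Y
    𝓝∪ {l} l∈ with j , S∪S′j , Ajl ← ∈𝓝⁻ l∈ | j ≟ r | to T-∨ S∪S′j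
    ... | no j≢r | inj₁ Sj  = from T-∨ (inj₁ (∈𝓝 Sj (delete-keeps-row j≢r Ajl)))
    ... | no j≢r | inj₂ S′j = from T-∨ (inj₂ (∈𝓝 S′j (delete-keeps-row j≢r Ajl)))
    ... | yes refl | _ with l ≟ x
    ...   | no l≢x   = from T-∨ (inj₁ (∈𝓝 Sr (delete-keeps-column l≢x Ajl)))
    ...   | yes refl = from T-∨ (inj₂ (∈𝓝 S′r (delete-keeps-column x≢y Ajl)))
    𝓝∩ : 𝓝 A (S ∩ S′ ─ r) ⊆ X ∩ Y
    𝓝∩ l∈ with j , j∈ , Ajl ← ∈𝓝⁻ l∈
          with S∩S′j , j≢r ← ∈─⁻ {S = S ∩ S′} j∈
          with Sj , S′j ← to T-∧ S∩S′j =
      from T-∧ ( ∈𝓝 Sj (delete-keeps-row j≢r Ajl)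
               , ∈𝓝 S′j (delete-keeps-row j≢r Ajl))

  Matching : Graph → Set
  Matching A = Σ (Fin N → Fin N) λ σ → Injective _≡_ _≡_ σ × ∀ j → T (A j (σ j))

  matching-of-subgraph : ∀ {A r x} → Matching (delete A r x) → Matching A
  matching-of-subgraph (σ , σ-injective , σ-edge) = σ , σ-injective , delete⊆ ∘ σ-edge

  matching-of-functional : ∀ A → HallCondition A
    → (∀ {r x y} → T (A r x) → T (A r y) → x ≡ y) → Matching A
  matching-of-functional A hallA functional = σ , σ-injective , proj₂ ∘ edge
    where
    edge : ∀ j → ∃ λ l → T (A j l)
    edge j with l , l∈ ← 0<card⇒nonempty (𝓝 A ⁅ j ⁆) (subst (_≤ card (𝓝 A ⁅ j ⁆)) (card⁅x⁆≡1 j) (hallA ⁅ j ⁆))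
           with j′ , j′∈ , Aj′l ← ∈𝓝⁻ l∈
           with refl ← ∈⁅x⁆⁻ j′∈ = l , Aj′l
    σ : Fin N → Fin N
    σ = proj₁ ∘ edge
    σ-injective : Injective _≡_ _≡_ σ
    σ-injective {i} {j} σi≡σj with i ≟ j
    ... | yes i≡j = i≡j
    ... | no  i≢j = ⊥-elim (<⇒≱ (s≤s (s≤s z≤n)) (begin
      2                  ≡⟨ cong suc (card⁅x⁆≡1 j) ⟨
      suc (card ⁅ j ⁆)   ≤⟨ s≤s (card-mono {S = ⁅ j ⁆} {S′ = S ─ i} j⊆S─i) ⟩
      suc (card (S ─ i)) ≡⟨ card≡1+card─ S i (from T-∨ (inj₁ (x∈⁅x⁆ i))) ⟨
      card S             ≤⟨ hallA S ⟩
      card (𝓝 A S)       ≤⟨ card-mono {S = 𝓝 A S} {S′ = ⁅ σ i ⁆} 𝓝S⊆ ⟩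
      card ⁅ σ i ⁆       ≡⟨ card⁅x⁆≡1 (σ i) ⟩
      1                  ∎))
      where
      open ≤-Reasoning
      S = ⁅ i ⁆ ∪ ⁅ j ⁆
      j⊆S─i : ⁅ j ⁆ ⊆ S ─ i
      j⊆S─i k∈ with refl ← ∈⁅x⁆⁻ k∈ = ∈─ (from T-∨ (inj₂ (x∈⁅x⁆ j))) (i≢j ∘ sym)
      𝓝S⊆ : 𝓝 A S ⊆ ⁅ σ i ⁆
      𝓝S⊆ {l} l∈ with k , k∈S , Akl ← ∈𝓝⁻ l∈ with to T-∨ k∈S
      ... | inj₁ k∈ with refl ← ∈⁅x⁆⁻ k∈ = subst (T ∘ ⁅ σ i ⁆) (sym (functional Akl (proj₂ (edge i)))) (x∈⁅x⁆ (σ i))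
      ... | inj₂ k∈ with refl ← ∈⁅x⁆⁻ k∈ =
        subst (T ∘ ⁅ σ i ⁆) (trans σi≡σj (sym (functional Akl (proj₂ (edge j))))) (x∈⁅x⁆ (σ i))

  two-edges-in-a-row? : (A : Graph)
    → Dec (∃ λ (r : Fin N) → ∃ λ (x : Fin N) → ∃ λ (y : Fin N) → x ≢ y × T (A r x) × T (A r y))
  two-edges-in-a-row? A = any? λ r → any? λ x → any? λ y → ¬? (x ≟ y) ×-dec T? (A r x) ×-dec T? (A r y)

  hall : ∀ A → HallCondition A → Matching A
  hall A = go A (<-wellFounded (edges A))
    where
    go : ∀ A → Acc _<_ (edges A) → HallCondition A → Matching A
    go A (acc smaller) hallA with two-edges-in-a-row? A
    ... | no ¬two = matching-of-functional A hallA functional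
      where
      functional : ∀ {r x y} → T (A r x) → T (A r y) → x ≡ y
      functional {r} {x} {y} Arx Ary with x ≟ y
      ... | yes x≡y = x≡y
      ... | no  x≢y = ⊥-elim (¬two (r , x , y , x≢y , Arx , Ary))
    ... | yes (r , x , y , x≢y , Arx , Ary) with deletion-preserves-Hall A r hallA x≢y
    ...   | inj₁ hall-x = matching-of-subgraph (go (delete A r x) (smaller (edges-delete Arx)) hall-x)
    ...   | inj₂ hall-y = matching-of-subgraph (go (delete A r y) (smaller (edges-delete Ary)) hall-y)

open Hall using (Graph; 𝓝; ∈𝓝; HallCondition; hall)

injective⇒surjective : ∀ {n} (σ : Fin n → Fin n) → Injective _≡_ _≡_ σ → ∀ y → ∃ λ x → σ x ≡ y
injective⇒surjective {suc n} σ σ-injective y with any? (λ x → σ x ≟ y)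
... | yes hit = hit
... | no  miss = ⊥-elim (<-irrefl refl (injective⇒≤ {f = σ′} σ′-injective))
  where
  σ≢y : ∀ x → y ≢ σ x
  σ≢y x y≡σx = miss (x , sym y≡σx)
  σ′ : Fin (suc n) → Fin n
  σ′ x = Fin.punchOut (σ≢y x)
  σ′-injective : Injective _≡_ _≡_ σ′
  σ′-injective {i} {j} = σ-injective ∘ punchOut-injective (σ≢y i) (σ≢y j)

injective⇒permutation : ∀ {n} (σ : Fin n → Fin n) → Injective _≡_ _≡_ σ → Fin n ↔ Fin n
injective⇒permutation σ σ-injective =
  mk↔ₛ′ σ (proj₁ ∘ surj) (proj₂ ∘ surj) (λ x → σ-injective (proj₂ (surj (σ x))))
  where surj = injective⇒surjective σ σ-injective

Regular : ∀ {N} → ℕ → (Fin N → Fin N → ℕ) → Set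
Regular a M = (∀ j → sum (M j) ≡ a) × (∀ l → sum (λ j → M j l) ≡ a)

support : ∀ {N} → (Fin N → Fin N → ℕ) → Graph
support M j l = 0 <ᵇ M j l

𝟙*-mono : ∀ {b b′} m → (T b → 0 < m → T b′) → 𝟙 b * m ≤ 𝟙 b′ * m
𝟙*-mono {false} m _ = z≤n
𝟙*-mono {true} zero _ = z≤n
𝟙*-mono {true} {b′} (suc m) b⇒b′ with b′ | b⇒b′ _ (s≤s z≤n)
... | true | _ = ≤-refl

regular⇒HallCondition : ∀ {N a} (M : Fin N → Fin N → ℕ) → Regular (suc a) M → HallCondition (support M)
regular⇒HallCondition {N} {a} M (rows , columns) S = *-cancelˡ-≤ (suc a) (begin
  suc a * card S                               ≡⟨ ℕΣ.*-distribˡ-sum (suc a) (𝟙 ∘ S) ⟩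
  sum (λ j → suc a * 𝟙 (S j))                  ≡⟨ sum-cong-≗ (λ j → weigh (S j) (M j) (rows j)) ⟩
  sum (λ j → sum (λ l → 𝟙 (S j) * M j l))      ≤⟨ sum-mono-≤ (λ j → sum-mono-≤ (λ l → 𝟙*-mono (M j l) (S⇒𝓝S j l))) ⟩
  sum (λ j → sum (λ l → 𝟙 (𝓝 A S l) * M j l))  ≡⟨ ∑-comm (λ j l → 𝟙 (𝓝 A S l) * M j l) ⟩
  sum (λ l → sum (λ j → 𝟙 (𝓝 A S l) * M j l))  ≡⟨ sum-cong-≗ (λ l → weigh (𝓝 A S l) (λ j → M j l) (columns l)) ⟨
  sum (λ l → suc a * 𝟙 (𝓝 A S l))              ≡⟨ ℕΣ.*-distribˡ-sum (suc a) (𝟙 ∘ 𝓝 A S) ⟨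
  suc a * card (𝓝 A S)                         ∎)
  where
  open ≤-Reasoning
  A = support M
  S⇒𝓝S : ∀ j l → T (S j) → 0 < M j l → T (𝓝 A S l)
  S⇒𝓝S j l Sj 0<M = ∈𝓝 Sj (<⇒<ᵇ 0<M)
  weigh : ∀ b (f : Fin N → ℕ) → sum f ≡ suc a → suc a * 𝟙 b ≡ sum (λ i → 𝟙 b * f i)
  weigh b f Σf = trans (*-comm (suc a) (𝟙 b)) (trans (cong (𝟙 b *_) (sym Σf)) (ℕΣ.*-distribˡ-sum (𝟙 b) f))

permutationMatrix : ∀ {N} → (Fin N → Fin N) → Fin N → Fin N → ℕ
permutationMatrix σ j l = 𝟙 (does (σ j ≟ l))

regular-permutationMatrix : ∀ {N} (π : Fin N ↔ Fin N) → Regular 1 (permutationMatrix (Inverse.to π))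
regular-permutationMatrix π = row , column
  where
  open Inverse π using (strictlyInverseˡ; strictlyInverseʳ) renaming (to to π⁺; from to π⁻)
  row : ∀ j → sum (permutationMatrix π⁺ j) ≡ 1
  row j = sum-𝟙≟ (π⁺ j)
  π⁺≡⇔π⁻≡ : ∀ j l → (π⁺ j ≡ l) ⇔ (π⁻ l ≡ j)
  π⁺≡⇔π⁻≡ j l = mk⇔ (λ { refl → strictlyInverseʳ j }) (λ { refl → strictlyInverseˡ l })
  column : ∀ l → sum (λ j → permutationMatrix π⁺ j l) ≡ 1
  column l = trans (sum-cong-≗ (λ j → cong 𝟙 (does-⇔ (π⁺≡⇔π⁻≡ j l) (π⁺ j ≟ l) (π⁻ l ≟ j)))) (sum-𝟙≟ (π⁻ l))

regular-difference : ∀ {N a} {M : Fin N → Fin N → ℕ} M′ P → Regular (suc a) M → Regular 1 P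
  → (∀ j l → M j l ≡ M′ j l + P j l) → Regular a M′
regular-difference {a = a} {M} M′ P (rows , columns) (rowsP , columnsP) M≡M′+P =
  (λ j → peel (M j) (M′ j) (P j) (M≡M′+P j) (rows j) (rowsP j)) ,
  (λ l → peel (λ j → M j l) (λ j → M′ j l) (λ j → P j l) (λ j → M≡M′+P j l) (columns l) (columnsP l))
  where
  peel : ∀ {n} (f g h : Fin n → ℕ) → (∀ i → f i ≡ g i + h i) → sum f ≡ suc a → sum h ≡ 1 → sum g ≡ a
  peel f g h f≡g+h Σf Σh = +-cancelʳ-≡ 1 (sum g) a (begin
    sum g + 1              ≡⟨ cong (_+_ (sum g)) Σh ⟨
    sum g + sum h          ≡⟨ ∑-distrib-+ g h ⟨
    sum (λ i → g i + h i)  ≡⟨ sum-cong-≗ f≡g+h ⟨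
    sum f                  ≡⟨ Σf ⟩
    suc a                  ≡⟨ +-comm 1 a ⟩
    a + 1                  ∎)
    where open ≡-Reasoning

module _ {N : ℕ} (c : Fin N → Fin N → ℕ) where

  cost : (Fin N → Fin N → ℕ) → ℕ
  cost M = sum λ j → sum λ l → M j l * c j l

  cost-+ : ∀ M M′ → cost (λ j l → M j l + M′ j l) ≡ cost M + cost M′
  cost-+ M M′ = begin
    cost (λ j l → M j l + M′ j l)
      ≡⟨ sum-cong-≗ (λ j → sum-cong-≗ (λ l → *-distribʳ-+ (c j l) (M j l) (M′ j l))) ⟩
    sum (λ j → sum (λ l → M j l * c j l + M′ j l * c j l))
      ≡⟨ sum-cong-≗ (λ j → ∑-distrib-+ (λ l → M j l * c j l) (λ l → M′ j l * c j l)) ⟩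
    sum (λ j → sum (λ l → M j l * c j l) + sum (λ l → M′ j l * c j l))
      ≡⟨ ∑-distrib-+ (λ j → sum (λ l → M j l * c j l)) (λ j → sum (λ l → M′ j l * c j l)) ⟩
    cost M + cost M′
      ∎
    where open ≡-Reasoning

  cost-cong : ∀ {M M′} → (∀ j l → M j l ≡ M′ j l) → cost M ≡ cost M′
  cost-cong M≡M′ = sum-cong-≗ (λ j → sum-cong-≗ (λ l → cong (_* c j l) (M≡M′ j l)))

  cost-permutationMatrix : ∀ σ → cost (permutationMatrix σ) ≡ sum (λ j → c j (σ j))
  cost-permutationMatrix σ = sum-cong-≗ (λ j → sum-pickʳ (σ j) (c j))

  -- Hall's theorem finds a permutation inside the support of M; removing it leaves an (a − 1)-regular matrix.
  regular-cost-bound : (C : ℤ) → (∀ (π : Fin N ↔ Fin N) → C ℤ.≤ + sum (λ j → c j (Inverse.to π j)))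
    → ∀ a M → Regular a M → + a ℤ.* C ℤ.≤ + cost M
  regular-cost-bound C C≤ zero M _ = ℤ.+≤+ z≤n
  regular-cost-bound C C≤ (suc a) M regular = begin
    + suc a ℤ.* C                        ≡⟨ ℤₚ.suc-* (+ a) C ⟩
    C ℤ.+ + a ℤ.* C                      ≤⟨ ℤₚ.+-mono-≤ (C≤ π) (regular-cost-bound C C≤ a M′ regular′) ⟩
    + sum (λ j → c j (σ j)) ℤ.+ + cost M′ ≡⟨ cong (ℤ._+ + cost M′) (cong +_ (cost-permutationMatrix σ)) ⟨
    + cost P ℤ.+ + cost M′               ≡⟨ ℤₚ.pos-+ (cost P) (cost M′) ⟨
    + (cost P + cost M′)                 ≡⟨ cong +_ (trans (+-comm (cost P) (cost M′)) (sym (cost-+ M′ P))) ⟩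
    + cost (λ j l → M′ j l + P j l)      ≡⟨ cong +_ (cost-cong (λ j l → M≡M′+P j l)) ⟨
    + cost M                             ∎
    where
    open ℤₚ.≤-Reasoning
    matching = hall (support M) (regular⇒HallCondition M regular)
    σ = proj₁ matching
    π = injective⇒permutation σ (proj₁ (proj₂ matching))
    P = permutationMatrix σ
    M′ : Fin N → Fin N → ℕ
    M′ j l = M j l ∸ P j l
    P≤M : ∀ j l → P j l ≤ M j l
    P≤M j l with σ j ≟ l
    ... | yes refl = <ᵇ⇒< 0 (M j (σ j)) (proj₂ (proj₂ matching) j)
    ... | no _     = z≤n
    M≡M′+P : ∀ j l → M j l ≡ M′ j l + P j l
    M≡M′+P j l = sym (m∸n+n≡m (P≤M j l))
    regular′ : Regular a M′
    regular′ = regular-difference M′ P regular (regular-permutationMatrix π) M≡M′+P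

sum-↑ : ∀ m n (g : Fin (m + n) → ℕ) → sum g ≡ sum (λ i → g (i Fin.↑ˡ n)) + sum (λ j → g (m Fin.↑ʳ j))
sum-↑ zero    n g = refl
sum-↑ (suc m) n g =
  trans (cong (_+_ (g Fin.zero)) (sum-↑ m n (g ∘ Fin.suc)))
        (sym (+-assoc (g Fin.zero) (sum (λ i → g (Fin.suc i Fin.↑ˡ n))) (sum (λ j → g (suc m Fin.↑ʳ j)))))

sum-combine : ∀ m n (g : Fin (m * n) → ℕ) → sum g ≡ sum (λ (i : Fin m) → sum (λ (j : Fin n) → g (Fin.combine i j)))
sum-combine zero    n g = refl
sum-combine (suc m) n g =
  trans (sum-↑ n (m * n) g) (cong (_+_ (sum (λ j → g (j Fin.↑ˡ (m * n))))) (sum-combine m n (g ∘ (n Fin.↑ʳ_))))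

∑² : ∀ {m n} → (Fin m × Fin n → ℕ) → ℕ
∑² f = sum λ i → sum λ j → f (i , j)

∑²≡sum∘remQuot : ∀ m n (f : Fin m × Fin n → ℕ) → ∑² f ≡ sum (f ∘ Fin.remQuot n)
∑²≡sum∘remQuot m n f =
  sym (trans (sum-combine m n (f ∘ Fin.remQuot n)) (sum-cong-≗ (λ i → sum-cong-≗ (λ j → cong f (remQuot-combine i j)))))

∑²-permute : ∀ {m n} (τ : (Fin m × Fin n) ↔ (Fin m × Fin n)) (f : Fin m × Fin n → ℕ)
  → ∑² (f ∘ Inverse.to τ) ≡ ∑² f
∑²-permute {m} {n} τ f = begin
  ∑² (f ∘ Inverse.to τ)                   ≡⟨ ∑²≡sum∘remQuot m n (f ∘ Inverse.to τ) ⟩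
  sum (f ∘ Inverse.to τ ∘ Fin.remQuot n)  ≡⟨ sum-cong-≗ (λ i → cong f (sym (uncurry remQuot-combine (τ⁺ i)))) ⟩
  sum (f ∘ Fin.remQuot n ∘ Inverse.to π)  ≡⟨ ℕΣ.sum-permute (f ∘ Fin.remQuot n) π ⟨
  sum (f ∘ Fin.remQuot n)                 ≡⟨ ∑²≡sum∘remQuot m n f ⟨
  ∑² f                                    ∎
  where
  open ≡-Reasoning
  τ⁺ = Inverse.to τ ∘ Fin.remQuot n
  π : Fin (m * n) ↔ Fin (m * n)
  π = ↔-sym *↔× ↔-∘ (τ ↔-∘ *↔×)

module _ {N a : ℕ} (τ : (Fin N × Fin a) ↔ (Fin N × Fin a)) where

  private
    τ₁ : Fin N → Fin a → Fin N
    τ₁ j k = proj₁ (Inverse.to τ (j , k))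

  occupancy : Fin N → Fin N → ℕ
  occupancy j l = sum λ k → 𝟙 (does (τ₁ j k ≟ l))

  regular-occupancy : Regular a occupancy
  regular-occupancy = row , column
    where
    open ≡-Reasoning
    row : ∀ j → sum (occupancy j) ≡ a
    row j = begin
      sum (λ l → sum (λ k → 𝟙 (does (τ₁ j k ≟ l))))        ≡⟨ ∑-comm (λ l k → 𝟙 (does (τ₁ j k ≟ l))) ⟩
      sum (λ k → sum (λ l → 𝟙 (does (τ₁ j k ≟ l))))        ≡⟨ sum-cong-≗ (λ k → sum-𝟙≟ (τ₁ j k)) ⟩
      sum {a} (λ _ → 1)                                    ≡⟨ trans (sum-const a 1) (*-identityʳ a) ⟩
      a                                                    ∎
    column : ∀ l → sum (λ j → occupancy j l) ≡ a
    column l = begin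
      ∑² (δ ∘ Inverse.to τ)                  ≡⟨ ∑²-permute τ δ ⟩
      sum (λ j → sum {a} (λ _ → 𝟙 (j≟l j)))  ≡⟨ sum-cong-≗ (λ j → trans (sum-const a _) (*-comm a (𝟙 (j≟l j)))) ⟩
      sum (λ j → 𝟙 (j≟l j) * a)              ≡⟨ sum-pickˡ l (λ _ → a) ⟩
      a                                      ∎
      where
      j≟l : Fin N → Bool
      j≟l j = does (j ≟ l)
      δ : Fin N × Fin a → ℕ
      δ x = 𝟙 (j≟l (proj₁ x))

  cost-occupancy : ∀ (c : Fin N → Fin N → ℕ)
    → cost c occupancy ≡ ∑² (λ x → c (proj₁ x) (proj₁ (Inverse.to τ x)))
  cost-occupancy c = sum-cong-≗ λ j → begin
    sum (λ l → sum (λ k → 𝟙 (does (τ₁ j k ≟ l))) * c j l)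
      ≡⟨ sum-cong-≗ (λ l → ℕΣ.*-distribʳ-sum (c j l) (λ k → 𝟙 (does (τ₁ j k ≟ l)))) ⟩
    sum (λ l → sum (λ k → 𝟙 (does (τ₁ j k ≟ l)) * c j l))
      ≡⟨ ∑-comm (λ l k → 𝟙 (does (τ₁ j k ≟ l)) * c j l) ⟩
    sum (λ k → sum (λ l → 𝟙 (does (τ₁ j k ≟ l)) * c j l))
      ≡⟨ sum-cong-≗ (λ k → sum-pickʳ (τ₁ j k) (c j)) ⟩
    sum (λ k → c j (τ₁ j k))
      ∎
    where open ≡-Reasoning

assignment-cost-bound : ∀ {N a} (c : Fin N → Fin N → ℕ) (C : ℤ)
  → (∀ (π : Fin N ↔ Fin N) → C ℤ.≤ + sum (λ j → c j (Inverse.to π j)))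
  → (τ : (Fin N × Fin a) ↔ (Fin N × Fin a))
  → + a ℤ.* C ℤ.≤ + ∑² (λ x → c (proj₁ x) (proj₁ (Inverse.to τ x)))
assignment-cost-bound {a = a} c C C≤ τ =
  subst (λ s → + a ℤ.* C ℤ.≤ + s) (cost-occupancy τ c)
        (regular-cost-bound c C C≤ a (occupancy τ) (regular-occupancy τ))

residue-of-representation : ∀ {d e einv} .{{_ : NonZero d}} → (e * einv) % d ≡ 1
  → ∀ x y → (einv * (d * x + e * y)) % d ≡ y % d
residue-of-representation {d} {e} {einv} inverse x y = begin
  (einv * (d * x + e * y)) % d               ≡⟨ cong (_% d) (expand einv d x e y) ⟩
  ((e * einv) * y + (einv * x) * d) % d      ≡⟨ [m+kn]%n≡m%n ((e * einv) * y) (einv * x) d ⟩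
  ((e * einv) * y) % d                       ≡⟨ %-distribˡ-* (e * einv) y d ⟩
  ((e * einv) % d * (y % d)) % d             ≡⟨ cong (λ r → (r * (y % d)) % d) inverse ⟩
  (1 * (y % d)) % d                          ≡⟨ cong (_% d) (*-identityˡ (y % d)) ⟩
  y % d % d                                  ≡⟨ m%n%n≡m%n y d ⟩
  y % d                                      ∎
  where
  open ≡-Reasoning
  expand : ∀ v d x e y → v * (d * x + e * y) ≡ (e * v) * y + (v * x) * d
  expand = solve-∀

representation-bound : ∀ {d e} x y {r} → e ≤ d → r ≤ y → d * x + e * y + (d ∸ e) * r ≤ d * (x + y)
representation-bound {d} {e} x y {r} e≤d r≤y = begin
  d * x + e * y + (d ∸ e) * r    ≤⟨ +-monoʳ-≤ (d * x + e * y) (*-monoʳ-≤ (d ∸ e) r≤y) ⟩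
  d * x + e * y + (d ∸ e) * y    ≡⟨ +-assoc (d * x) (e * y) ((d ∸ e) * y) ⟩
  d * x + (e * y + (d ∸ e) * y)  ≡⟨ cong (_+_ (d * x)) (*-distribʳ-+ y e (d ∸ e)) ⟨
  d * x + (e + (d ∸ e)) * y      ≡⟨ cong (λ s → d * x + s * y) (m+[n∸m]≡n e≤d) ⟩
  d * x + d * y                  ≡⟨ *-distribˡ-+ d x y ⟨
  d * (x + y)                    ∎
  where open ≤-Reasoning

φ-bound : ∀ {d e einv} .{{_ : NonZero d}} → e ≤ d → IsInvMod d e einv → ∀ {k m} → IsPhi d e k m
  → k ℤ.+ + (d ∸ e) ℤ.* + ((+ einv ℤ.* k) %ℕ d) ℤ.≤ + d ℤ.* + m
φ-bound {d} {e} {einv} e≤d inverse {k} {m} ((x , y , dx+ey≡k , x+y≡m) , _) = begin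
  k ℤ.+ D ℤ.* + ((+ einv ℤ.* k) %ℕ d)
    ≡⟨ cong (λ k → k ℤ.+ D ℤ.* + ((+ einv ℤ.* k) %ℕ d)) k≡ ⟨
  + k′ ℤ.+ D ℤ.* + ((+ einv ℤ.* + k′) %ℕ d)
    ≡⟨ cong (λ z → + k′ ℤ.+ D ℤ.* + (z %ℕ d)) (ℤₚ.pos-* einv k′) ⟨
  + k′ ℤ.+ D ℤ.* + ((einv * k′) % d)
    ≡⟨ cong (λ r → + k′ ℤ.+ D ℤ.* + r) (residue-of-representation {d} {e} {einv} e*einv≡1 x y) ⟩
  + k′ ℤ.+ D ℤ.* + (y % d)
    ≡⟨ cong (ℤ._+_ (+ k′)) (ℤₚ.pos-* (d ∸ e) (y % d)) ⟨
  + (k′ + (d ∸ e) * (y % d))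
    ≤⟨ ℤ.+≤+ (representation-bound x y e≤d (m%n≤m y d)) ⟩
  + (d * (x + y))
    ≡⟨ cong (λ s → + (d * s)) x+y≡m ⟩
  + (d * m)
    ≡⟨ ℤₚ.pos-* d m ⟩
  + d ℤ.* + m
    ∎
  where
  open ℤₚ.≤-Reasoning
  D = + (d ∸ e)
  k′ = d * x + e * y
  k≡ : + k′ ≡ k
  k≡ = trans (ℤₚ.pos-+ (d * x) (e * y)) (trans (cong₂ ℤ._+_ (ℤₚ.pos-* d x) (ℤₚ.pos-* e y)) dx+ey≡k)
  e*einv≡1 : (e * einv) % d ≡ 1
  e*einv≡1 = trans (cong (_%ℕ d) (ℤₚ.pos-* e einv)) inverse

sum-suc : ∀ {n} (f : Fin n → ℕ) → sum (λ i → suc (f i)) ≡ n + sum f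
sum-suc {n} f = trans (∑-distrib-+ (λ _ → 1) f) (cong (_+ sum f) (trans (sum-const n 1) (*-identityʳ n)))

gauss : ∀ n → 2 * sum {suc n} toℕ ≡ n * (n + 1)
gauss zero    = refl
gauss (suc n) = begin
  2 * sum {suc n} (λ i → suc (toℕ i))  ≡⟨ cong (2 *_) (sum-suc (toℕ {suc n})) ⟩
  2 * (suc n + sum {suc n} toℕ)        ≡⟨ *-distribˡ-+ 2 (suc n) (sum {suc n} toℕ) ⟩
  2 * suc n + 2 * sum {suc n} toℕ      ≡⟨ cong (_+_ (2 * suc n)) (gauss n) ⟩
  2 * suc n + n * (n + 1)              ≡⟨ complete-square n ⟩
  suc n * (suc n + 1)                  ∎
  where
  open ≡-Reasoning
  complete-square : ∀ n → 2 * suc n + n * (n + 1) ≡ suc n * (suc n + 1)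
  complete-square = solve-∀

∑²-proj₁ : ∀ N a → ∑² {N} {a} (toℕ ∘ proj₁) ≡ a * sum {N} toℕ
∑²-proj₁ N a = begin
  sum {N} (λ j → sum {a} (λ _ → toℕ j)) ≡⟨ sum-cong-≗ (λ (j : Fin N) → sum-const a (toℕ j)) ⟩
  sum {N} (λ j → a * toℕ j)             ≡⟨ ℕΣ.*-distribˡ-sum a (toℕ {N}) ⟨
  a * sum {N} toℕ                       ∎
  where open ≡-Reasoning

sumFin-cong : ∀ {n} {f g : Fin n → ℤ} → (∀ i → f i ≡ g i) → sumFin n f ≡ sumFin n g
sumFin-cong {zero}  f≗g = refl
sumFin-cong {suc n} f≗g = cong₂ ℤ._+_ (f≗g Fin.zero) (sumFin-cong (f≗g ∘ Fin.suc))

sumFin-mono-≤ : ∀ {n} {f g : Fin n → ℤ} → (∀ i → f i ℤ.≤ g i) → sumFin n f ℤ.≤ sumFin n g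
sumFin-mono-≤ {zero}  f≤g = ℤₚ.≤-refl
sumFin-mono-≤ {suc n} f≤g = ℤₚ.+-mono-≤ (f≤g Fin.zero) (sumFin-mono-≤ (f≤g ∘ Fin.suc))

sumFin-+ : ∀ n (f g : Fin n → ℤ) → sumFin n (λ i → f i ℤ.+ g i) ≡ sumFin n f ℤ.+ sumFin n g
sumFin-+ zero    f g = refl
sumFin-+ (suc n) f g = trans (cong (ℤ._+_ (f Fin.zero ℤ.+ g Fin.zero)) (sumFin-+ n (f ∘ Fin.suc) (g ∘ Fin.suc)))
                             (ℤ+.interchange (f Fin.zero) (g Fin.zero) (sumFin n (f ∘ Fin.suc)) (sumFin n (g ∘ Fin.suc)))

sumFin-*ˡ : ∀ n u (f : Fin n → ℤ) → sumFin n (λ i → u ℤ.* f i) ≡ u ℤ.* sumFin n f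
sumFin-*ˡ zero    u f = sym (ℤₚ.*-zeroʳ u)
sumFin-*ˡ (suc n) u f = trans (cong (ℤ._+_ (u ℤ.* f Fin.zero)) (sumFin-*ˡ n u (f ∘ Fin.suc)))
                              (sym (ℤₚ.*-distribˡ-+ u (f Fin.zero) (sumFin n (f ∘ Fin.suc))))

sumFin-neg : ∀ n (f : Fin n → ℤ) → sumFin n (λ i → ℤ.- f i) ≡ ℤ.- sumFin n f
sumFin-neg zero    f = refl
sumFin-neg (suc n) f = trans (cong (ℤ._+_ (ℤ.- f Fin.zero)) (sumFin-neg n (f ∘ Fin.suc)))
                             (sym (ℤₚ.neg-distrib-+ (f Fin.zero) (sumFin n (f ∘ Fin.suc))))

sumFin-const : ∀ n u → sumFin n (λ _ → u) ≡ + n ℤ.* u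
sumFin-const zero    u = sym (ℤₚ.*-zeroˡ u)
sumFin-const (suc n) u = trans (cong (ℤ._+_ u) (sumFin-const n u)) (sym (ℤₚ.suc-* (+ n) u))

sumFin-pos : ∀ n (f : Fin n → ℕ) → sumFin n (λ i → + f i) ≡ + sum f
sumFin-pos zero    f = refl
sumFin-pos (suc n) f = trans (cong (ℤ._+_ (+ f Fin.zero)) (sumFin-pos n (f ∘ Fin.suc))) (sym (ℤₚ.pos-+ (f Fin.zero) (sum (f ∘ Fin.suc))))

sumFin² : ∀ {N a} → (Fin N × Fin a → ℤ) → ℤ
sumFin² {N} {a} f = sumFin N λ j → sumFin a λ k → f (j , k)

module _ {N a : ℕ} where

  sumFin²-mono-≤ : ∀ {f g : Fin N × Fin a → ℤ} → (∀ x → f x ℤ.≤ g x) → sumFin² f ℤ.≤ sumFin² g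
  sumFin²-mono-≤ f≤g = sumFin-mono-≤ (λ j → sumFin-mono-≤ (λ k → f≤g (j , k)))

  sumFin²-+ : ∀ (f g : Fin N × Fin a → ℤ) → sumFin² (λ x → f x ℤ.+ g x) ≡ sumFin² f ℤ.+ sumFin² g
  sumFin²-+ f g = trans (sumFin-cong (λ j → sumFin-+ a (λ k → f (j , k)) (λ k → g (j , k))))
                        (sumFin-+ N (λ j → sumFin a (λ k → f (j , k))) (λ j → sumFin a (λ k → g (j , k))))

  sumFin²-*ˡ : ∀ u (f : Fin N × Fin a → ℤ) → sumFin² (λ x → u ℤ.* f x) ≡ u ℤ.* sumFin² f
  sumFin²-*ˡ u f = trans (sumFin-cong (λ j → sumFin-*ˡ a u (λ k → f (j , k))))
                         (sumFin-*ˡ N u (λ j → sumFin a (λ k → f (j , k))))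

  sumFin²-neg : ∀ (f : Fin N × Fin a → ℤ) → sumFin² (λ x → ℤ.- f x) ≡ ℤ.- sumFin² f
  sumFin²-neg f = trans (sumFin-cong (λ j → sumFin-neg a (λ k → f (j , k))))
                        (sumFin-neg N (λ j → sumFin a (λ k → f (j , k))))

  sumFin²-const : ∀ u → sumFin² {N} {a} (λ _ → u) ≡ + N ℤ.* (+ a ℤ.* u)
  sumFin²-const u = trans (sumFin-cong {N} (λ _ → sumFin-const a u)) (sumFin-const N (+ a ℤ.* u))

  sumFin²-pos : ∀ (f : Fin N × Fin a → ℕ) → sumFin² (λ x → + f x) ≡ + ∑² f
  sumFin²-pos f = trans (sumFin-cong (λ j → sumFin-pos a (λ k → f (j , k)))) (sumFin-pos N (λ j → sum (λ k → f (j , k))))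

  summed-φ-bound : ∀ {d e einv} .{{_ : NonZero d}} → e ≤ d → IsInvMod d e einv
    → (K : Fin N × Fin a → ℤ) (m : Fin N × Fin a → ℕ) → (∀ x → IsPhi d e (K x) (m x))
    → sumFin² K ℤ.+ + (d ∸ e) ℤ.* + ∑² (λ x → (+ einv ℤ.* K x) %ℕ d) ℤ.≤ + d ℤ.* sumFin² (λ x → + m x)
  summed-φ-bound {d} {e} {einv} e≤d inverse K m isφ = begin
    sumFin² K ℤ.+ D ℤ.* + ∑² r                   ≡⟨ cong (λ s → sumFin² K ℤ.+ D ℤ.* s) (sumFin²-pos r) ⟨
    sumFin² K ℤ.+ D ℤ.* sumFin² (λ x → + r x)    ≡⟨ cong (ℤ._+_ (sumFin² K)) (sumFin²-*ˡ D (λ x → + r x)) ⟨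
    sumFin² K ℤ.+ sumFin² (λ x → D ℤ.* + r x)    ≡⟨ sumFin²-+ K (λ x → D ℤ.* + r x) ⟨
    sumFin² (λ x → K x ℤ.+ D ℤ.* + r x)          ≤⟨ sumFin²-mono-≤ (λ x → φ-bound e≤d inverse (isφ x)) ⟩
    sumFin² (λ x → + d ℤ.* + m x)                ≡⟨ sumFin²-*ˡ (+ d) (λ x → + m x) ⟩
    + d ℤ.* sumFin² (λ x → + m x)                ∎
    where
    open ℤₚ.≤-Reasoning
    D = + (d ∸ e)
    r : Fin N × Fin a → ℕ
    r x = (+ einv ℤ.* K x) %ℕ d

  sumFin²-φ-arguments : ∀ p t (τ : (Fin N × Fin a) ↔ (Fin N × Fin a)) →
    sumFin² (λ x → (+ p ℤ.* + toℕ (proj₁ x)) ℤ.- + toℕ (proj₁ (Inverse.to τ x)) ℤ.+ t)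
    ≡ + p ℤ.* + (a * sum {N} toℕ) ℤ.- + (a * sum {N} toℕ) ℤ.+ + N ℤ.* (+ a ℤ.* t)
  sumFin²-φ-arguments p t τ = begin
    sumFin² (λ x → P x ℤ.- Q x ℤ.+ t)
      ≡⟨ sumFin²-+ (λ x → P x ℤ.- Q x) (λ _ → t) ⟩
    sumFin² (λ x → P x ℤ.- Q x) ℤ.+ sumFin² {N} {a} (λ _ → t)
      ≡⟨ cong₂ ℤ._+_ (trans (sumFin²-+ P (ℤ.-_ ∘ Q)) (cong (ℤ._+_ (sumFin² P)) (sumFin²-neg Q))) (sumFin²-const t) ⟩
    sumFin² P ℤ.- sumFin² Q ℤ.+ + N ℤ.* (+ a ℤ.* t)
      ≡⟨ cong₂ (λ u v → u ℤ.- v ℤ.+ + N ℤ.* (+ a ℤ.* t)) ΣP ΣQ ⟩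
    + p ℤ.* + (a * sum {N} toℕ) ℤ.- + (a * sum {N} toℕ) ℤ.+ + N ℤ.* (+ a ℤ.* t)
      ∎
    where
    open ≡-Reasoning
    P Q : Fin N × Fin a → ℤ
    P x = + p ℤ.* + toℕ (proj₁ x)
    Q x = + toℕ (proj₁ (Inverse.to τ x))
    ΣP : sumFin² P ≡ + p ℤ.* + (a * sum {N} toℕ)
    ΣP = trans (sumFin²-*ˡ (+ p) (λ x → + toℕ (proj₁ x)))
               (cong (ℤ._*_ (+ p)) (trans (sumFin²-pos (toℕ ∘ proj₁)) (cong +_ (∑²-proj₁ N a))))
    ΣQ : sumFin² Q ≡ + (a * sum {N} toℕ)
    ΣQ = trans (sumFin²-pos (toℕ ∘ proj₁ ∘ Inverse.to τ))
               (cong +_ (trans (∑²-permute τ (toℕ ∘ proj₁)) (∑²-proj₁ N a)))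

bound-in-summed-form : ∀ p n a t {d e} C → e ≤ d →
  + a ℤ.* (+ (p * n * (n + 1)) ℤ.+ + 2 ℤ.* (+ (n + 1) ℤ.* t) ℤ.+ + 2 ℤ.* ((+ d ℤ.- + e) ℤ.* C))
  ≡ + 2 ℤ.* (+ suc p ℤ.* + (a * sum {suc n} toℕ) ℤ.- + (a * sum {suc n} toℕ)
             ℤ.+ + suc n ℤ.* (+ a ℤ.* t) ℤ.+ + (d ∸ e) ℤ.* (+ a ℤ.* C))
bound-in-summed-form p n a t {d} {e} C e≤d = begin
  + a ℤ.* (+ (p * n * (n + 1)) ℤ.+ + 2 ℤ.* (+ (n + 1) ℤ.* t) ℤ.+ + 2 ℤ.* ((+ d ℤ.- + e) ℤ.* C))
    ≡⟨ cong₂ (λ u v → + a ℤ.* (u ℤ.+ + 2 ℤ.* (+ (n + 1) ℤ.* t) ℤ.+ + 2 ℤ.* (v ℤ.* C))) twice-triangle d-e≡D ⟩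
  + a ℤ.* (+ p ℤ.* (+ 2 ℤ.* G) ℤ.+ + 2 ℤ.* (+ (n + 1) ℤ.* t) ℤ.+ + 2 ℤ.* (D ℤ.* C))
    ≡⟨ ring (+ a) (+ p) G (+ (n + 1)) t D C ⟩
  + 2 ℤ.* ((+ p ℤ.+ + 1) ℤ.* (+ a ℤ.* G) ℤ.- + a ℤ.* G ℤ.+ + (n + 1) ℤ.* (+ a ℤ.* t) ℤ.+ D ℤ.* (+ a ℤ.* C))
    ≡⟨ cong₂ (λ u v → + 2 ℤ.* (u ℤ.* v ℤ.- v ℤ.+ + (n + 1) ℤ.* (+ a ℤ.* t) ℤ.+ D ℤ.* (+ a ℤ.* C)))
             (trans (sym (ℤₚ.pos-+ p 1)) (cong +_ (+-comm p 1)))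
             (sym (ℤₚ.pos-* a (sum {suc n} toℕ))) ⟩
  + 2 ℤ.* (+ suc p ℤ.* + (a * sum {suc n} toℕ) ℤ.- + (a * sum {suc n} toℕ)
           ℤ.+ + (n + 1) ℤ.* (+ a ℤ.* t) ℤ.+ D ℤ.* (+ a ℤ.* C))
    ≡⟨ cong (λ N → + 2 ℤ.* (+ suc p ℤ.* + (a * sum {suc n} toℕ) ℤ.- + (a * sum {suc n} toℕ)
                            ℤ.+ + N ℤ.* (+ a ℤ.* t) ℤ.+ D ℤ.* (+ a ℤ.* C)))
            (+-comm n 1) ⟩
  + 2 ℤ.* (+ suc p ℤ.* + (a * sum {suc n} toℕ) ℤ.- + (a * sum {suc n} toℕ)
           ℤ.+ + suc n ℤ.* (+ a ℤ.* t) ℤ.+ D ℤ.* (+ a ℤ.* C))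
    ∎
  where
  open ≡-Reasoning
  G = + sum {suc n} toℕ
  D = + (d ∸ e)
  twice-triangle : + (p * n * (n + 1)) ≡ + p ℤ.* (+ 2 ℤ.* G)
  twice-triangle = trans (cong +_ (trans (*-assoc p n (n + 1)) (cong (p *_) (sym (gauss n)))))
                         (trans (ℤₚ.pos-* p (2 * sum {suc n} toℕ)) (cong (ℤ._*_ (+ p)) (ℤₚ.pos-* 2 (sum {suc n} toℕ))))
  d-e≡D : + d ℤ.- + e ≡ D
  d-e≡D = trans (ℤₚ.[+m]-[+n]≡m⊖n d e) (ℤₚ.⊖-≥ e≤d)
  ring : ∀ A P G N t D C → A ℤ.* (P ℤ.* (+ 2 ℤ.* G) ℤ.+ + 2 ℤ.* (N ℤ.* t) ℤ.+ + 2 ℤ.* (D ℤ.* C))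
       ≡ + 2 ℤ.* ((P ℤ.+ + 1) ℤ.* (A ℤ.* G) ℤ.- A ℤ.* G ℤ.+ N ℤ.* (A ℤ.* t) ℤ.+ D ℤ.* (A ℤ.* C))
  ring = ℤSolver.solve-∀

lemma2p7 : (p d e a : ℕ) (t : ℤ) (n : ℕ) .{{_ : NonZero d}}
    → Prime p → Coprime d e → 1 ℕ.≤ e → e ℕ.< d → 1 ℕ.≤ a
    → (einv : ℕ) → IsInvMod d e einv
    → (C : ℤ) → IsC d einv p t n C
    → (τ : (Fin (suc n) × Fin a) ↔ (Fin (suc n) × Fin a))
    → (m : Fin (suc n) × Fin a → ℕ)
    → (∀ i → IsPhi d e ((+ p ℤ.* + toℕ (proj₁ i)) ℤ.- + toℕ (proj₁ (Inverse.to τ i)) ℤ.+ t) (m i))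
    → (+ a ℤ.* ((+ ((p ℕ.∸ 1) ℕ.* n ℕ.* (n ℕ.+ 1)))
                ℤ.+ (+ 2 ℤ.* (+ (n ℕ.+ 1) ℤ.* t))
                ℤ.+ (+ 2 ℤ.* ((+ d ℤ.- + e) ℤ.* C))))
      ℤ.≤ + 2 ℤ.* + d ℤ.* sumFin (suc n) (λ j → sumFin a (λ k → + m (j , k)))
-- Primality only excludes p = 0, where p ∸ 1 is not p − 1; coprimality of d and e is subsumed by einv.
lemma2p7 zero _ _ _ _ _ 0-prime _ _ _ _ _ _ _ _ _ _ _ = ⊥-elim (¬prime[0] 0-prime)
lemma2p7 p@(suc p-1) d e a t n _ _ _ e<d _ einv inverse C (_ , C≤cost) τ m isφ = begin
  + a ℤ.* (+ (p-1 * n * (n + 1)) ℤ.+ + 2 ℤ.* (+ (n + 1) ℤ.* t) ℤ.+ + 2 ℤ.* ((+ d ℤ.- + e) ℤ.* C))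
    ≡⟨ bound-in-summed-form p-1 n a t C e≤d ⟩
  + 2 ℤ.* (+ p ℤ.* + (a * G) ℤ.- + (a * G) ℤ.+ + N ℤ.* (+ a ℤ.* t) ℤ.+ D ℤ.* (+ a ℤ.* C))
    ≡⟨ cong (λ s → + 2 ℤ.* (s ℤ.+ D ℤ.* (+ a ℤ.* C))) (sumFin²-φ-arguments p t τ) ⟨
  + 2 ℤ.* (sumFin² K ℤ.+ D ℤ.* (+ a ℤ.* C))
    ≤⟨ ℤₚ.*-monoˡ-≤-nonNeg (+ 2) (ℤₚ.+-monoʳ-≤ (sumFin² K) (ℤₚ.*-monoˡ-≤-nonNeg D aC≤cost)) ⟩
  + 2 ℤ.* (sumFin² K ℤ.+ D ℤ.* + ∑² (λ x → c (proj₁ x) (proj₁ (Inverse.to τ x))))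
    ≤⟨ ℤₚ.*-monoˡ-≤-nonNeg (+ 2) (summed-φ-bound e≤d inverse K m isφ) ⟩
  + 2 ℤ.* (+ d ℤ.* sumFin² (λ x → + m x))
    ≡⟨ ℤₚ.*-assoc (+ 2) (+ d) (sumFin² (λ x → + m x)) ⟨
  + 2 ℤ.* + d ℤ.* sumFin² (λ x → + m x)
    ∎
  where
  open ℤₚ.≤-Reasoning
  N = suc n
  G = sum {N} toℕ
  D = + (d ∸ e)
  e≤d = <⇒≤ e<d
  K : Fin N × Fin a → ℤ
  K x = (+ p ℤ.* + toℕ (proj₁ x)) ℤ.- + toℕ (proj₁ (Inverse.to τ x)) ℤ.+ t
  c : Fin N → Fin N → ℕ
  c j l = (+ einv ℤ.* ((+ p ℤ.* + toℕ j) ℤ.- + toℕ l ℤ.+ t)) %ℕ d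
  C≤cost′ : ∀ σ → C ℤ.≤ + sum (λ j → c j (Inverse.to σ j))
  C≤cost′ σ = subst (C ℤ.≤_) (sumFin-pos N (λ j → c j (Inverse.to σ j))) (C≤cost σ)
  aC≤cost : + a ℤ.* C ℤ.≤ + ∑² (λ x → c (proj₁ x) (proj₁ (Inverse.to τ x)))
  aC≤cost = assignment-cost-bound c C C≤cost′ τ
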